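{- (Subsumption of Hoare Logic.) In the nondeterministic (Boolean semiring) interpretation, for every well-formed program $C$ and all $P,Q\subseteq\Sigma$, the following are equivalent: (i) $\models\langle [P]\rangle\, C\,\langle\square Q\rangle$; (ii) $P\subseteq\mathsf{Box}_C(Q)$; (iii) the Hoare triple $\{P\}\,C\,\{Q\}$ is valid.
   Context: The semiring is $\mathsf{Bool}=\langle\{0,1\},\lor,\land,0,1\rangle$. $\mathcal W(\Sigma)$ is the set of functions $m:\Sigma\to\{0,1\}$ (i.e. sets of states), $\mathrm{supp}(m)=\{\sigma:m(\sigma)=1\}$, $|m|=\bigvee_{\sigma}m(\sigma)$; $\eta(\sigma)$ is the singleton at $\sigma$; $f^\dagger(m)(\tau)=\bigvee_{\sigma\in\mathrm{supp}(m)}f(\sigma)(\tau)$. Programs $C::=\mathsf{skip}\mid C_1;C_2\mid C_1+C_2\mid\mathsf{assume}\ e\mid C^{\langle e,e'\rangle}\mid a$ ($a$ atomic with given $[\![a]\!]:\Sigma\to\mathcal W(\Sigma)$, $e$ a Boolean test over primitive tests $t\subseteq\Sigma$ or a weight in $\{0,1\}$) with semantics $[\![\mathsf{skip}]\!]=\eta$, $[\![C_1;C_2]\!](\sigma)=[\![C_2]\!]^\dagger([\![C_1]\!](\sigma))$, $[\![C_1+C_2]\!](\sigma)=[\![C_1]\!](\sigma)\lor[\![C_2]\!](\sigma)$ pointwise, $[\![\mathsf{assume}\ e]\!](\sigma)=[\![e]\!](\sigma)\cdot\eta(\sigma)$, and $[\![C^{\langle e,e'\rangle}]\!]$ the least fixed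 point of $\Phi(f)(\sigma)=[\![e]\!](\sigma)\cdot f^\dagger([\![C]\!](\sigma))\lor[\![e']\!](\sigma)\cdot\eta(\sigma)$. Outcome assertions are subsets of $\mathcal W(\Sigma)$; $[P]=\{m:|m|=1,\ \mathrm{supp}(m)\subseteq P\}$; $\square Q=\{m:\mathrm{supp}(m)\subseteq Q\}$. $\models\langle\varphi\rangle C\langle\psi\rangle$ iff $[\![C]\!]^\dagger(m)\in\psi$ for all $m\in\varphi$. $\mathsf{Box}_C(Q)=\{\sigma:\mathrm{supp}([\![C]\!](\sigma))\subseteq Q\}$. The Hoare triple $\{P\}C\{Q\}$ is valid iff for every $\sigma\in P$, every $\tau\in\mathrm{supp}([\![C]\!](\sigma))$ lies in $Q$. -}

module Defs where

open import Data.Nat using (ℕ; zero; suc)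
open import Data.Product using (Σ-syntax; ∃-syntax; _×_)
open import Data.Sum using (_⊎_)
open import Data.Empty using (⊥)
open import Data.Unit using (⊤)
open import Relation.Nullary using (¬_)
open import Relation.Binary.PropositionalEquality using (_≡_)

-- Boolean semiring {0,1} with ∨, ∧ : a weight/truth value is a proposition
-- (1 = inhabited, 0 = empty); ∨ is _⊎_ / ∃, ∧ is _×_.

W : Set → Set₁
W S = S → Set

supp : {S : Set} → W S → S → Set
supp m = m

∣_∣ : {S : Set} → W S → Set
∣ m ∣ = ∃[ σ ] m σ

η : {S : Set} → S → W S
η σ τ = σ ≡ τ

_† : {S : Set} → (S → W S) → W S → W S
(f †) m τ = ∃[ σ ] (m σ × f σ τ)

data Test (S : Set) : Set₁ where
  w0 w1 : Test S
  prim  : (S → Set) → Test S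
  not   : Test S → Test S
  and   : Test S → Test S → Test S
  or    : Test S → Test S → Test S

⟦_⟧ₜ : {S : Set} → Test S → S → Set
⟦ w0 ⟧ₜ σ = ⊥
⟦ w1 ⟧ₜ σ = ⊤
⟦ prim t ⟧ₜ σ = t σ
⟦ not e ⟧ₜ σ = ¬ ⟦ e ⟧ₜ σ
⟦ and e e' ⟧ₜ σ = ⟦ e ⟧ₜ σ × ⟦ e' ⟧ₜ σ
⟦ or e e' ⟧ₜ σ = ⟦ e ⟧ₜ σ ⊎ ⟦ e' ⟧ₜ σ

-- Programs; an atomic action is given directly by its semantics ⟦a⟧ : Σ → W(Σ).
data Prog (S : Set) : Set₁ where
  skip   : Prog S
  _⨾_    : Prog S → Prog S → Prog S
  _⊕_    : Prog S → Prog S → Prog S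
  assume : Test S → Prog S
  iter   : Prog S → Test S → Test S → Prog S
  atom   : (S → W S) → Prog S

Φ : {S : Set} → (S → W S) → Test S → Test S → (S → W S) → (S → W S)
Φ c e e' f σ τ = (⟦ e ⟧ₜ σ × (f †) (c σ) τ) ⊎ (⟦ e' ⟧ₜ σ × η σ τ)

Φ^ : {S : Set} → (S → W S) → Test S → Test S → ℕ → (S → W S)
Φ^ c e e' zero σ τ = ⊥
Φ^ c e e' (suc n) = Φ c e e' (Φ^ c e e' n)

-- Least fixed point of Φ (Φ is Scott-continuous: lfp = ⋁ₙ Φⁿ(⊥))
lfp : {S : Set} → (S → W S) → Test S → Test S → (S → W S)
lfp c e e' σ τ = ∃[ n ] Φ^ c e e' n σ τ

⟦_⟧ : {S : Set} → Prog S → S → W S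
⟦ skip ⟧ = η
⟦ C₁ ⨾ C₂ ⟧ σ = (⟦ C₂ ⟧ †) (⟦ C₁ ⟧ σ)
⟦ C₁ ⊕ C₂ ⟧ σ τ = ⟦ C₁ ⟧ σ τ ⊎ ⟦ C₂ ⟧ σ τ
⟦ assume e ⟧ σ τ = ⟦ e ⟧ₜ σ × η σ τ
⟦ iter C e e' ⟧ = lfp ⟦ C ⟧ e e'
⟦ atom a ⟧ = a

Assertion : Set → Set₁
Assertion S = W S → Set

[_] : {S : Set} → (S → Set) → Assertion S
[ P ] m = ∣ m ∣ × (∀ σ → supp m σ → P σ)

□ : {S : Set} → (S → Set) → Assertion S
□ Q m = ∀ σ → supp m σ → Q σ

⊨⟨_⟩_⟨_⟩ : {S : Set} → Assertion S → Prog S → Assertion S → Set₁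
⊨⟨ φ ⟩ C ⟨ ψ ⟩ = ∀ m → φ m → ψ ((⟦ C ⟧ †) m)

Box : {S : Set} → Prog S → (S → Set) → S → Set
Box C Q σ = ∀ τ → supp (⟦ C ⟧ σ) τ → Q τ

_⊆_ : {S : Set} → (S → Set) → (S → Set) → Set
P ⊆ Q = ∀ σ → P σ → Q σ

HoareValid : {S : Set} → (S → Set) → Prog S → (S → Set) → Set
HoareValid P C Q = ∀ σ → P σ → ∀ τ → supp (⟦ C ⟧ σ) τ → Q τ

{-# OPTIONS --safe #-}
module Submission where

-- Kleisli extension along a singleton gives back the image of its point, so
-- the precondition [P] may be tested on singletons η σ with σ ∈ P; and ⟦C⟧† m
-- is supported on the union of the ⟦C⟧ σ for σ ∈ supp m.  Box and Hoare
-- validity unfold to the same proposition.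

open import Defs
open import Data.Product using (_×_; _,_)
open import Function.Base using (id)
open import Function.Bundles using (_⇔_; mk⇔)
open import Relation.Binary.PropositionalEquality using (refl)

module _ {S : Set} where

  η∈[_] : {P : S → Set} {σ : S} → P σ → [ P ] (η σ)
  η∈[ p ] = (_ , refl) , λ { _ refl → p }

  ⊆-†-η : (f : S → W S) (σ : S) → f σ ⊆ (f †) (η σ)
  ⊆-†-η f σ τ fστ = σ , refl , fστ

  †-preserves-□ : (f : S → W S) {Q : S → Set} {m : W S} →
                  (∀ σ → m σ → □ Q (f σ)) → □ Q ((f †) m)
  †-preserves-□ f f⊆Q τ (σ , mσ , fστ) = f⊆Q σ mσ τ fστ

theorem5p1 : {S : Set} (C : Prog S) (P Q : S → Set) →
    ((⊨⟨ [ P ] ⟩ C ⟨ □ Q ⟩) ⇔ (P ⊆ Box C Q)) × ((P ⊆ Box C Q) ⇔ HoareValid P C Q)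
theorem5p1 C P Q = mk⇔ outcome⇒box box⇒outcome , mk⇔ id id
  where
  outcome⇒box : ⊨⟨ [ P ] ⟩ C ⟨ □ Q ⟩ → P ⊆ Box C Q
  outcome⇒box triple σ p τ τ∈Cσ = triple (η σ) η∈[ p ] τ (⊆-†-η ⟦ C ⟧ σ τ τ∈Cσ)

  box⇒outcome : P ⊆ Box C Q → ⊨⟨ [ P ] ⟩ C ⟨ □ Q ⟩
  box⇒outcome P⊆Box m (_ , m⊆P) = †-preserves-□ ⟦ C ⟧ λ σ mσ → P⊆Box σ (m⊆P σ mσ)
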